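{- Let $\ell>2$, let $\lambda$ be an $(\ell,0)$-JM partition and let $i$ be a residue. Then there is no ladder containing both a removable box of $\lambda$ of residue $i$ and an addable position of $\lambda$ of residue $i$ with the removable box lying in a higher row (smaller row index) than the addable position.
   Context: Partitions are identified with Young diagrams; $(x,y)$ is the box in row $x$, column $y$, with residue $y-x\bmod\ell$. A removable box is a box of $\lambda$ whose removal leaves a partition; an addable position is a position not in $\lambda$ whose addition gives a partition. The ladder of a position $(a,b)$ is the set of positions $(c,d)$ ($c,d\ge1$) with $c+(\ell-1)d=a+(\ell-1)b$; positions on one ladder have the same residue. The hook length $h^\lambda_{(a,c)}$ of a box is the number of boxes of $\lambda$ to its right in its row or below it in its column, including itself. $\lambda$ is an $(\ell,0)$-JM partition if there do NOT exist boxes $(a,b),(a,y),(x,b)$ in $\lambda$ with $\ell\mid h^\lambda_{(a,b)}$, $\ell\nmid h^\lambda_{(a,y)}$, $\ell\nmid h^\lambda_{(x,b)}$. -}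

module Defs where

open import Data.Nat using (ℕ; zero; suc; _+_; _*_; _∸_; _≤_; _<_; _≥_; _≤?_)
open import Data.Nat.Divisibility using (_∣_)
open import Data.Integer using (ℤ; +_; _-_)
open import Data.Integer.DivMod using (_%ℕ_)
open import Data.List using (List; []; _∷_; length; filter)
open import Data.List.Relation.Unary.All using (All)
open import Data.List.Relation.Unary.Linked using (Linked)
open import Data.Product using (_×_; ∃-syntax)
open import Data.Sum using (_⊎_)
open import Relation.Binary.PropositionalEquality using (_≡_)
open import Relation.Nullary using (¬_)

IsPartition : List ℕ → Set
IsPartition λ' = Linked _≥_ λ' × All (0 <_) λ'

-- rowLen λ x = λ_x, the length of row x (rows indexed from 1; 0 beyond the end)
rowLen : List ℕ → ℕ → ℕ
rowLen []       _             = 0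
rowLen (_ ∷ _)  zero          = 0
rowLen (r ∷ _)  (suc zero)    = r
rowLen (_ ∷ rs) (suc (suc k)) = rowLen rs (suc k)

colLen : List ℕ → ℕ → ℕ
colLen λ' b = length (filter (b ≤?_) λ')

Box : List ℕ → ℕ → ℕ → Set
Box λ' x y = 1 ≤ x × 1 ≤ y × y ≤ rowLen λ' x

hook : List ℕ → ℕ → ℕ → ℕ
hook λ' a b = (rowLen λ' a ∸ b) + (colLen λ' b ∸ a) + 1

-- residue of position (x,y): (y - x) mod ℓ, as a natural in [0,ℓ)  (ℓ = 0 never used)
residue : ℕ → ℕ → ℕ → ℕ
residue zero    x y = 0
residue (suc k) x y = ((+ y) - (+ x)) %ℕ (suc k)

Removable : List ℕ → ℕ → ℕ → Set
Removable λ' x y = Box λ' x y × y ≡ rowLen λ' x × rowLen λ' (suc x) < y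

Addable : List ℕ → ℕ → ℕ → Set
Addable λ' x y = 1 ≤ x × y ≡ suc (rowLen λ' x) × (x ≡ 1 ⊎ y ≤ rowLen λ' (x ∸ 1))

SameLadder : ℕ → ℕ → ℕ → ℕ → ℕ → Set
SameLadder ℓ a b c d = c + (ℓ ∸ 1) * d ≡ a + (ℓ ∸ 1) * b

IsJM : ℕ → List ℕ → Set
IsJM ℓ λ' = ¬ (∃[ a ] ∃[ b ] ∃[ x ] ∃[ y ]
  (Box λ' a b × Box λ' a y × Box λ' x b ×
   ℓ ∣ hook λ' a b × ¬ (ℓ ∣ hook λ' a y) × ¬ (ℓ ∣ hook λ' x b)))

module Submission where

-- Let (r,c) be removable and (a,b) addable on one ladder with r < a, and
-- put m = ℓ - 1.  The ladder equation a + m·b = r + m·c forces c = b + k and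
-- a = r + m·k for some k ≥ 1.  Column b has length a - 1 (it ends just above the
-- addable position), so the box (r,b) has arm k and leg t = m·k - 1; its hook is
-- k + m·k = ℓ·k, divisible by ℓ.  The removable box (r,c) has hook 1, not divisible by ℓ.
-- Finally, going down column b from row r to row r + t the hooks strictly decrease;
-- if all t + 1 of them were multiples of ℓ they would drop by ℓ per step, giving
-- 1 + ℓ·t ≤ ℓ·k, impossible since t ≥ k when m ≥ 2.  So some box (x,b) below (r,b) has
-- hook prime to ℓ, and the boxes (r,b), (r,c), (x,b) violate the JM condition.

open import Defs
open import Data.Nat using (ℕ; zero; suc; _+_; _*_; _∸_; _≤_; _<_; _≥_; z≤n; s≤s; >-nonZero)
open import Data.Nat.Properties
open import Data.Nat.Divisibility using (_∣_; _∣?_; ∣⇒≤; ∣m+n∣m⇒∣n; m∣m*n)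
open import Data.Fin using (Fin; toℕ; fromℕ<)
open import Data.Fin.Properties using (¬∀⟶∃¬; toℕ≤pred[n]; toℕ-fromℕ<)
open import Data.List using (List; []; _∷_)
open import Data.List.Properties using (filter-accept; filter-reject)
open import Data.List.Relation.Unary.All as All using (All; []; _∷_)
open import Data.List.Relation.Unary.Linked using (Linked; tail)
open import Data.List.Relation.Unary.Linked.Properties using (Linked⇒All)
open import Data.Product using (_×_; _,_; ∃-syntax; proj₁; proj₂)
open import Data.Sum as Sum using (_⊎_; inj₁; inj₂)
open import Data.Empty using (⊥; ⊥-elim)
open import Relation.Nullary using (¬_; yes; no)
open import Relation.Binary.PropositionalEquality

entries-≤-head : ∀ {h t} → Linked _≥_ (h ∷ t) → All (_≤ h) (h ∷ t)
entries-≤-head = Linked⇒All (λ y≤x z≤y → ≤-trans z≤y y≤x) ≤-refl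

rowLen-bounded : ∀ {h L} → All (_≤ h) L → ∀ x → rowLen L x ≤ h
rowLen-bounded []       _             = z≤n
rowLen-bounded (_ ∷ _)  zero          = z≤n
rowLen-bounded (p ∷ _)  (suc zero)    = p
rowLen-bounded (_ ∷ ps) (suc (suc x)) = rowLen-bounded ps (suc x)

rowLen-antitone : ∀ {L} → Linked _≥_ L → ∀ {x y} → x ≤ y → rowLen L (suc y) ≤ rowLen L (suc x)
rowLen-antitone {[]}    _      _               = z≤n
rowLen-antitone {h ∷ t} sorted {zero}  {y} _   = rowLen-bounded (entries-≤-head sorted) (suc y)
rowLen-antitone {h ∷ t} sorted {suc x} {suc y} (s≤s x≤y) = rowLen-antitone (tail sorted) x≤y

box-above : ∀ {L} → Linked _≥_ L → ∀ {n x y} → Box L n y → 1 ≤ x → x ≤ n → Box L x y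
box-above sorted {suc n} {suc x} (_ , 1≤y , y≤row) _ (s≤s x≤n) =
  s≤s z≤n , 1≤y , ≤-trans y≤row (rowLen-antitone sorted x≤n)

colLen-empty : ∀ {b L} → All (_< b) L → colLen L b ≡ 0
colLen-empty [] = refl
colLen-empty {b} {x ∷ xs} (x<b ∷ xs<b)
  rewrite filter-reject (b ≤?_) {x} {xs} (<⇒≱ x<b) = colLen-empty xs<b

colLen-exact : ∀ L → Linked _≥_ L → ∀ n b →
  rowLen L (suc n) < b → (n ≡ 0 ⊎ b ≤ rowLen L n) → colLen L b ≡ n
colLen-exact []      _      zero    _ _  _              = refl
colLen-exact []      _      (suc n) _ _  (inj₁ ())
colLen-exact []      _      (suc n) _ () (inj₂ z≤n)
colLen-exact (h ∷ t) sorted zero    b h<b _ =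
  colLen-empty (All.map (λ x≤h → ≤-<-trans x≤h h<b) (entries-≤-head sorted))
colLen-exact (h ∷ t) sorted (suc n) b _   (inj₁ ())
colLen-exact (h ∷ t) sorted (suc n) b below (inj₂ b≤row)
  rewrite filter-accept (b ≤?_) {h} {t} (≤-trans b≤row (rowLen-bounded (entries-≤-head sorted) (suc n))) =
  cong suc (colLen-exact t (tail sorted) n b below (reaches n b≤row))
  where
  -- row n+1 of h ∷ t is row n of t
  reaches : ∀ n → b ≤ rowLen (h ∷ t) (suc n) → n ≡ 0 ⊎ b ≤ rowLen t n
  reaches zero    _     = inj₁ refl
  reaches (suc n) b≤row = inj₂ b≤row

-- A removable box (r,c) is the bottom of column c, so its hook length is 1.
removable-hook : ∀ {L r c} → Linked _≥_ L → Removable L r c → hook L r c ≡ 1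
removable-hook {L} {r} {c} sorted (_ , c≡row , below) = begin
  (rowLen L r ∸ c) + (colLen L c ∸ r) + 1
    ≡⟨ cong₂ (λ R C → (R ∸ c) + (C ∸ r) + 1) (sym c≡row) column-length ⟩
  (c ∸ c) + (r ∸ r) + 1
    ≡⟨ cong₂ (λ u v → u + v + 1) (n∸n≡0 c) (n∸n≡0 r) ⟩
  1 ∎
  where
  open ≡-Reasoning
  column-length : colLen L c ≡ r
  column-length = colLen-exact L sorted r c below (inj₂ (≤-reflexive c≡row))

addable-colLen : ∀ {L N b} → Linked _≥_ L → Addable L (suc N) b → colLen L b ≡ N
addable-colLen {L} {N} {b} sorted (_ , b≡ , above) =
  colLen-exact L sorted N b (subst (rowLen L (suc N) <_) (sym b≡) ≤-refl) (Sum.map₁ suc-injective above)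

addable-above : ∀ {L N b} → Addable L (suc N) b → 1 ≤ N → Box L N b
addable-above {N = suc N} (_ , _  , inj₁ ())      _
addable-above {N = suc N} (_ , b≡ , inj₂ b≤row) _ = s≤s z≤n , subst (1 ≤_) (sym b≡) (s≤s z≤n) , b≤row

corner-hook : ∀ {L r c N b k} → Linked _≥_ L → Removable L r c → Addable L (suc N) b →
  c ≡ b + k → hook L r b ≡ k + (N ∸ r) + 1
corner-hook {L} {r} {c} {N} {b} {k} sorted (_ , c≡row , _) addable c≡b+k = begin
  (rowLen L r ∸ b) + (colLen L b ∸ r) + 1
    ≡⟨ cong₂ (λ R C → (R ∸ b) + (C ∸ r) + 1) (sym c≡row) (addable-colLen {L} sorted addable) ⟩
  (c ∸ b) + (N ∸ r) + 1
    ≡⟨ cong (λ arm → arm + (N ∸ r) + 1) (trans (cong (_∸ b) c≡b+k) (m+n∸m≡n b k)) ⟩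
  k + (N ∸ r) + 1 ∎
  where open ≡-Reasoning

-- Going down a column, hook lengths strictly decrease: the arm weakly shrinks, the leg by one.
hook-descends : ∀ {L} → Linked _≥_ L → ∀ x y →
  suc x < colLen L y → hook L (suc (suc x)) y < hook L (suc x) y
hook-descends sorted x y x<col =
  +-monoˡ-< 1 (+-mono-≤-< (∸-monoˡ-≤ y (rowLen-antitone sorted (n≤1+n x)))
                          (∸-monoʳ-< (n<1+n (suc x)) x<col))

multiples-gap : ∀ {ℓ p q} → ℓ ∣ p → ℓ ∣ q → p < q → p + ℓ ≤ q
multiples-gap {ℓ} {p} {q} ℓ∣p ℓ∣q p<q = begin
  p + ℓ       ≤⟨ +-monoʳ-≤ p (∣⇒≤ {{>-nonZero (m<n⇒0<n∸m p<q)}} ℓ∣q∸p) ⟩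
  p + (q ∸ p) ≡⟨ m+[n∸m]≡n (<⇒≤ p<q) ⟩
  q           ∎
  where
  open ≤-Reasoning
  ℓ∣q∸p : ℓ ∣ q ∸ p
  ℓ∣q∸p = ∣m+n∣m⇒∣n (subst (ℓ ∣_) (sym (m+[n∸m]≡n (<⇒≤ p<q))) ℓ∣q) ℓ∣p

multiples-descent : ∀ ℓ (g : ℕ → ℕ) d →
  (∀ x → x < d → g (suc x) < g x) → (∀ x → x ≤ d → ℓ ∣ g x) → g d + ℓ * d ≤ g 0
multiples-descent ℓ g zero _ _ = ≤-reflexive (trans (cong (g 0 +_) (*-zeroʳ ℓ)) (+-identityʳ (g 0)))
multiples-descent ℓ g (suc d) descending multiple = begin
  g (suc d) + ℓ * suc d   ≡⟨ cong (g (suc d) +_) (*-suc ℓ d) ⟩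
  g (suc d) + (ℓ + ℓ * d) ≡⟨ +-assoc (g (suc d)) ℓ (ℓ * d) ⟨
  g (suc d) + ℓ + ℓ * d   ≤⟨ +-monoˡ-≤ (ℓ * d) step ⟩
  g d + ℓ * d             ≤⟨ multiples-descent ℓ g d (λ x x<d → descending x (m<n⇒m<1+n x<d))
                                                     (λ x x≤d → multiple x (m≤n⇒m≤1+n x≤d)) ⟩
  g 0                     ∎
  where
  open ≤-Reasoning
  step : g (suc d) + ℓ ≤ g d
  step = multiples-gap (multiple (suc d) ≤-refl) (multiple d (n≤1+n d)) (descending d ≤-refl)

non-multiple-in-column : ∀ {L} ℓ → Linked _≥_ L → ∀ r b k t → 1 ≤ r →
  colLen L b ≡ r + t → hook L r b ≡ ℓ * k → k ≤ t →
  ∃[ d ] d ≤ t × ¬ (ℓ ∣ hook L (r + d) b)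
non-multiple-in-column {L} ℓ sorted (suc r) b k t _ col top k≤t
  with ¬∀⟶∃¬ (suc t) (λ i → ℓ ∣ g (toℕ i)) (λ i → ℓ ∣? g (toℕ i)) not-all-multiples
  where
  g : ℕ → ℕ
  g d = hook L (suc r + d) b

  descending : ∀ d → d < t → g (suc d) < g d
  descending d d<t =
    subst (λ row → hook L row b < g d) (cong suc (sym (+-suc r d)))
          (hook-descends sorted (r + d) b (subst (suc (r + d) <_) (sym col) (+-monoʳ-< (suc r) d<t)))

  -- all t + 1 hooks being multiples of ℓ would force 1 + ℓ·t ≤ ℓ·k ≤ ℓ·t
  not-all-multiples : ¬ (∀ (i : Fin (suc t)) → ℓ ∣ g (toℕ i))
  not-all-multiples all-multiples = <-irrefl refl (begin-strict
    ℓ * k         ≤⟨ *-monoʳ-≤ ℓ k≤t ⟩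
    ℓ * t         <⟨ +-monoˡ-≤ (ℓ * t) (m≤n+m 1 _) ⟩
    g t + ℓ * t   ≤⟨ multiples-descent ℓ g t descending multiple ⟩
    g 0           ≡⟨ cong (λ row → hook L row b) (+-identityʳ (suc r)) ⟩
    hook L (suc r) b ≡⟨ top ⟩
    ℓ * k         ∎)
    where
    open ≤-Reasoning
    multiple : ∀ d → d ≤ t → ℓ ∣ g d
    multiple d d≤t = subst (λ e → ℓ ∣ g e) (toℕ-fromℕ< (s≤s d≤t)) (all-multiples (fromℕ< (s≤s d≤t)))
... | i , ¬ℓ∣ = toℕ i , toℕ≤pred[n] i , ¬ℓ∣

ladder-offset : ∀ {ℓ r c a b} → SameLadder ℓ r c a b → r < a →
  ∃[ k ] 1 ≤ k × c ≡ b + k × a ≡ r + (ℓ ∸ 1) * k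
ladder-offset {ℓ} {r} {c} {a} {b} ladder r<a = c ∸ b , m<n⇒0<n∸m b<c , sym (m+[n∸m]≡n (<⇒≤ b<c)) , a≡
  where
  m = ℓ ∸ 1
  b<c : b < c
  b<c with b <? c
  ... | yes b<c = b<c
  ... | no  b≮c = ⊥-elim (<⇒≱ (begin-strict
          r + m * c ≤⟨ +-monoʳ-≤ r (*-monoʳ-≤ m (≮⇒≥ b≮c)) ⟩
          r + m * b <⟨ +-monoˡ-< (m * b) r<a ⟩
          a + m * b ∎) (≤-reflexive ladder))
    where open ≤-Reasoning
  a≡ : a ≡ r + m * (c ∸ b)
  a≡ = +-cancelʳ-≡ (m * b) a (r + m * (c ∸ b)) (begin
    a + m * b                 ≡⟨ ladder ⟩
    r + m * c                 ≡⟨ cong (λ z → r + m * z) (m+[n∸m]≡n (<⇒≤ b<c)) ⟨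
    r + m * (b + (c ∸ b))     ≡⟨ cong (r +_) (*-distribˡ-+ m b (c ∸ b)) ⟩
    r + (m * b + m * (c ∸ b)) ≡⟨ cong (r +_) (+-comm (m * b) (m * (c ∸ b))) ⟩
    r + (m * (c ∸ b) + m * b) ≡⟨ +-assoc r (m * (c ∸ b)) (m * b) ⟨
    r + m * (c ∸ b) + m * b   ∎)
    where open ≡-Reasoning

corner-hook-value : ∀ m k t → suc t ≡ m * k → k + t + 1 ≡ suc m * k
corner-hook-value m k t span = begin
  k + t + 1   ≡⟨ +-assoc k t 1 ⟩
  k + (t + 1) ≡⟨ cong (k +_) (+-comm t 1) ⟩
  k + suc t   ≡⟨ cong (k +_) span ⟩
  k + m * k   ∎
  where open ≡-Reasoning

arm-≤-leg : ∀ m k t → 2 ≤ m → 1 ≤ k → suc t ≡ m * k → k ≤ t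
arm-≤-leg m k t 2≤m 1≤k span = ≤-pred (begin
  suc k     ≡⟨ +-comm 1 k ⟩
  k + 1     ≤⟨ +-monoʳ-≤ k 1≤k ⟩
  k + k     ≡⟨ cong (k +_) (+-identityʳ k) ⟨
  2 * k     ≤⟨ *-monoˡ-≤ k 2≤m ⟩
  m * k     ≡⟨ span ⟨
  suc t     ∎)
  where open ≤-Reasoning

-- The boxes (r,b), (r,c), (r+d,b) violate the JM condition: the corner hook is ℓ·k, the
-- removable box has hook 1, and d is supplied by non-multiple-in-column.
lemma4p5 : (ℓ : ℕ) → 2 < ℓ → (λ' : List ℕ) → IsPartition λ' → IsJM ℓ λ' →
    (i : ℕ) → (r c a b : ℕ) →
    Removable λ' r c → residue ℓ r c ≡ i →
    Addable λ' a b → residue ℓ a b ≡ i →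
    SameLadder ℓ r c a b → r < a → ⊥
lemma4p5 zero () _ _ _ _ _ _ _ _ _ _ _ _ _ _
lemma4p5 (suc m) _ _ _ _ _ _ _ zero _ _ _ _ _ _ ()
lemma4p5 (suc m) 2<ℓ λ' (sorted , _) jm _ r c (suc N) b removable@((1≤r , _) , _) _ addable _ ladder r<a
  with ladder-offset {suc m} ladder r<a
... | k , 1≤k , c≡b+k , a≡ =
  jm (r , b , r + d , c , box-rb , proj₁ removable , box-below , ℓ∣corner , ¬ℓ∣removable , ¬ℓ∣below)
  where
  ℓ : ℕ
  ℓ = suc m
  r≤N : r ≤ N
  r≤N = ≤-pred r<a
  t : ℕ
  t = N ∸ r
  N≡r+t : N ≡ r + t
  N≡r+t = sym (m+[n∸m]≡n r≤N)
  span : suc t ≡ m * k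
  span = trans (sym (+-∸-assoc 1 r≤N)) (trans (cong (_∸ r) a≡) (m+n∸m≡n r (m * k)))
  corner : hook λ' r b ≡ ℓ * k
  corner = trans (corner-hook {λ'} sorted removable addable c≡b+k) (corner-hook-value m k t span)
  ℓ∣corner : ℓ ∣ hook λ' r b
  ℓ∣corner = subst (ℓ ∣_) (sym corner) (m∣m*n k)
  ¬ℓ∣removable : ¬ (ℓ ∣ hook λ' r c)
  ¬ℓ∣removable ℓ∣ = <⇒≱ (<-trans (n<1+n 1) 2<ℓ) (∣⇒≤ (subst (ℓ ∣_) (removable-hook sorted removable) ℓ∣))
  below : ∃[ d ] d ≤ t × ¬ (ℓ ∣ hook λ' (r + d) b)
  below = non-multiple-in-column ℓ sorted r b k t 1≤r (trans (addable-colLen {λ'} sorted addable) N≡r+t)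
            corner (arm-≤-leg m k t (≤-pred 2<ℓ) 1≤k span)
  d : ℕ
  d = proj₁ below
  ¬ℓ∣below : ¬ (ℓ ∣ hook λ' (r + d) b)
  ¬ℓ∣below = proj₂ (proj₂ below)
  box-N : Box λ' N b
  box-N = addable-above {λ'} addable (≤-trans 1≤r r≤N)
  box-rb : Box λ' r b
  box-rb = box-above sorted box-N 1≤r r≤N
  box-below : Box λ' (r + d) b
  box-below = box-above sorted box-N (≤-trans 1≤r (m≤m+n r d))
                (subst (r + d ≤_) (sym N≡r+t) (+-monoʳ-≤ r (proj₁ (proj₂ below))))
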